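{- Let $X$ be a finite pure simplicial complex of dimension $d\in\mathbb{N}$ with $n\geq 1$ vertices. The following are equivalent: (1) $X$ is linearly shellable; (2) there exists a bijection $\sigma:V(X)\to[n]$ such that, for the induced injective map $\sigma_X:X\to[n]^{d+1}_<$, the lexicographic order on $\operatorname{im}(\sigma_X)$ is a shelling order; (3) there exists a bijection $\sigma:V(X)\to[n]$ such that, for the induced map $\sigma_X:X\to[n]^{d+1}_<$, every linear extension of the poset $\operatorname{im}(\sigma_X)$ (with the Bruhat order) is a shelling order.
   Context: $[n]=\{1,\dots,n\}$. $[n]^k_<$ is the set of strictly increasing $k$-tuples $x=(x_1<\dots<x_k)$ with entries in $[n]$, identified with $k$-element subsets of $[n]$; it carries the Bruhat (Gale) order: $x\le y$ iff $x_i\le y_i$ for all $i\in[k]$. The lexicographic order $<_{lex}$ on $[n]^k_<$ is a linear extension of it. A pure simplicial complex is identified with its set of facets; a bijection $\sigma:V(X)\to[n]$ sends each facet (a $(d+1)$-set of vertices) to an element of $[n]^{d+1}_<$, giving $\sigma_X$, and $\operatorname{im}(\sigma_X)$ is an induced subposet of $[n]^{d+1}_<$. A linear extension of a finite poset $P$ with $|P|=h$ is a listing $(C_1,\dots,C_h)$ of its elements such that $C_i<C_j$ implies $i<j$. A sequence $(C_1,\dots,C_h)$ of distinct elements of $[n]^k_<$ is a shelling order if for all $i<j$ in $[h]$ there exists $r<j$ with $C_r=C_j+\{a,b\}$ (symmetric difference), where $a\in C_j\setminus C_i$ and $b\in C_r\setminus C_j$. $X$ is linearly shellable if there exists a bijection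 $\sigma:V(X)\to[n]$ such that the induced subposet $\operatorname{im}(\sigma_X)\subseteq[n]^{d+1}_<$ has a linear extension which is a shelling order. -}

module Defs where

open import Data.Nat using (ℕ; suc)
open import Data.Fin using (Fin; _≤_; _<_)
open import Data.Fin.Properties using (≤-decTotalOrder)
open import Data.List using (List; length; map; lookup)
open import Data.List.Membership.Propositional using (_∈_; _∉_)
open import Data.List.Relation.Unary.All using (All)
open import Data.List.Relation.Unary.AllPairs using (AllPairs)
open import Data.List.Relation.Unary.Unique.Propositional using (Unique)
open import Data.List.Relation.Binary.Pointwise using (Pointwise)
open import Data.List.Relation.Binary.Lex.Strict using (Lex-<)
open import Data.List.Relation.Binary.Permutation.Propositional using (_↭_)
open import Data.Product using (Σ; ∃; ∃-syntax; _×_)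
open import Data.Sum using (_⊎_)
open import Relation.Binary.PropositionalEquality using (_≡_; _≢_)
open import Relation.Nullary using (¬_)
open import Function.Bundles using (_⤖_; _⇔_; Bijection)

-- An element of [n]^k_< is represented as a strictly increasing list of
-- elements of Fin n (of length k); Fin n plays the role of [n].
Tuple : ℕ → Set
Tuple n = List (Fin n)

StrictlyIncreasing : ∀ {n} → Tuple n → Set
StrictlyIncreasing = AllPairs _<_

_≤B_ : ∀ {n} → Tuple n → Tuple n → Set
x ≤B y = Pointwise _≤_ x y

_<B_ : ∀ {n} → Tuple n → Tuple n → Set
x <B y = x ≤B y × x ≢ y

_<lex_ : ∀ {n} → Tuple n → Tuple n → Set
_<lex_ = Lex-< _≡_ _<_

-- A finite pure simplicial complex of dimension d whose vertex set is
-- identified with Fin n (n vertices).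
record PureComplex (n d : ℕ) : Set where
  field
    facets        : List (Tuple n)
    facet-sorted  : All StrictlyIncreasing facets
    facet-size    : All (λ F → length F ≡ suc d) facets
    facets-unique : Unique facets
    -- V(X) is the vertex set: every vertex lies in some facet
    covers        : ∀ (v : Fin n) → ∃[ F ] (F ∈ facets × v ∈ F)
open PureComplex public

import Data.List.Sort

sortFin : ∀ {n} → Tuple n → Tuple n
sortFin {n} = Data.List.Sort.sort (≤-decTotalOrder n)

σ-facet : ∀ {n} → (Fin n ⤖ Fin n) → Tuple n → Tuple n
σ-facet σ F = sortFin (map (Bijection.to σ) F)

image : ∀ {n d} → (Fin n ⤖ Fin n) → PureComplex n d → List (Tuple n)
image σ X = map (σ-facet σ) (facets X)

IsSymDiff : ∀ {n} → Tuple n → Tuple n → Fin n → Fin n → Set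
IsSymDiff C D a b = ∀ v → (v ∈ C) ⇔ ((v ∈ D × ¬ (v ≡ a ⊎ v ≡ b)) ⊎ (v ∉ D × (v ≡ a ⊎ v ≡ b)))

ShellingOrder : ∀ {n} → List (Tuple n) → Set
ShellingOrder Cs = Unique Cs ×
  (∀ (i j : Fin (length Cs)) → i < j →
     Σ (Fin (length Cs)) λ r → r < j × Σ (Fin _) λ a → Σ (Fin _) λ b →
       (a ∈ lookup Cs j × a ∉ lookup Cs i) ×
       (b ∈ lookup Cs r × b ∉ lookup Cs j) ×
       IsSymDiff (lookup Cs r) (lookup Cs j) a b)

LinearExtension : ∀ {n} → List (Tuple n) → List (Tuple n) → Set
LinearExtension P L = (L ↭ P) ×
  (∀ (i j : Fin (length L)) → lookup L i <B lookup L j → i < j)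

LexListing : ∀ {n} → List (Tuple n) → List (Tuple n) → Set
LexListing P L = (L ↭ P) × AllPairs _<lex_ L

LinearlyShellable : ∀ {n d} → PureComplex n d → Set
LinearlyShellable X = ∃[ σ ] ∃[ L ] (LinearExtension (image σ X) L × ShellingOrder L)

LexShellable : ∀ {n d} → PureComplex n d → Set
LexShellable X = ∃[ σ ] ∃[ L ] (LexListing (image σ X) L × ShellingOrder L)

AllExtensionsShell : ∀ {n d} → PureComplex n d → Set
AllExtensionsShell X = ∃[ σ ] (∀ L → LinearExtension (image σ X) L → ShellingOrder L)

module Submission where

-- In a shelling step the earlier facet R = C_j + {a, b} arises from C_j by exchanging a
-- single vertex, and two increasing tuples differing in a single entry are comparable in
-- the Bruhat order.  If R precedes C_j in a shelling linear extension, R cannot lie above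
-- C_j, so R < C_j, and R precedes C_j in every linear extension.  Hence shelling steps
-- transfer from one linear extension L₀ to any other L: for C before D in L, either C also
-- precedes D in L₀ and the L₀-step is reused, or D precedes C in L₀, and the L₀-step for
-- (D, C) yields an R before C in L whose step for (R, D), by induction on the position of
-- C, also serves (C, D).  The lexicographic order extends the Bruhat order, which gives the
-- remaining implications.

open import Defs
open import Data.Empty using (⊥-elim)
open import Data.Fin using (Fin; zero; suc; _<_; _≤_)
open import Data.Fin.Induction using (<-wellFounded)
open import Data.Fin.Properties
  using (≤-refl; ≤-antisym; ≤∧≢⇒<; <-irrefl; <-asym; <-trans; <-cmp; <⇒≢; <-resp₂-≡;
         _≟_; ≤-totalOrder; ≤-decTotalOrder; <-strictTotalOrder)
open import Data.List using (List; []; _∷_; length; lookup)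
open import Data.List.Membership.Propositional using (_∈_; _∉_)
open import Data.List.Membership.Propositional.Properties using (∈-lookup; ∈-map⁻)
open import Data.List.Relation.Binary.Lex.Core using (base; halt; this; next)
open import Data.List.Relation.Binary.Lex.Strict as Lex using (Lex-≤; <-asymmetric)
open import Data.List.Relation.Binary.Permutation.Propositional
  using (_↭_; ↭-sym; ↭-trans; ↭⇒↭ₛ)
open import Data.List.Relation.Binary.Permutation.Propositional.Properties using (∈-resp-↭)
import Data.List.Relation.Binary.Permutation.Setoid.Properties as PermutationSetoid
import Data.List.Relation.Binary.Pointwise as Pointwise
open import Data.List.Relation.Binary.Pointwise using ([]; _∷_)
open import Data.List.Relation.Binary.Subset.Propositional using (_⊆_)
import Data.List.Relation.Unary.All as All
open import Data.List.Relation.Unary.AllPairs as AllPairs using (AllPairs; _∷_)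
open import Data.List.Relation.Unary.Any using (here; there; index)
open import Data.List.Relation.Unary.Any.Properties using (lookup-index)
open import Data.List.Relation.Unary.Sorted.TotalOrder.Properties using (Sorted⇒AllPairs)
open import Data.List.Relation.Unary.Unique.Propositional using (Unique)
import Data.List.Relation.Unary.Unique.Propositional.Properties as Unique
import Data.List.Sort as Sort
open import Data.Nat using (ℕ; s≤s; _≥_)
import Data.Nat.Properties as ℕ
open import Data.Product using (Σ-syntax; _×_; _,_; ∃₂; proj₂)
open import Data.Sum using (_⊎_; inj₁; inj₂; [_,_])
open import Function.Bundles using (_⇔_; mk⇔; Equivalence; _⤖_; Bijection)
open import Induction.WellFounded using (Acc; acc)
open import Level using (0ℓ)
open import Relation.Binary.Bundles using (DecTotalOrder)
open import Relation.Binary.Definitions using (tri<; tri≈; tri>)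
open import Relation.Binary.PropositionalEquality
  using (_≡_; _≢_; refl; sym; trans; cong; subst; subst₂; setoid)
open import Relation.Nullary using (¬_; yes; no)

open Equivalence using (to; from)

private variable
  n : ℕ
  a b x y : Fin n
  xs ys R C : Tuple n

-- Exchanging one entry of an increasing tuple

head-≤ : StrictlyIncreasing (x ∷ xs) → y ∈ x ∷ xs → x ≤ y
head-≤ _          (here refl)  = ≤-refl
head-≤ (x<xs ∷ _) (there y∈xs) = ℕ.<⇒≤ (All.lookup x<xs y∈xs)

head-< : StrictlyIncreasing (x ∷ xs) → y ∈ xs → x < y
head-< (x<xs ∷ _) = All.lookup x<xs

tail-≢-head : StrictlyIncreasing (x ∷ xs) → y ∈ xs → y ≢ x
tail-≢-head sx y∈xs y≡x = <⇒≢ (head-< sx y∈xs) (sym y≡x)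

∈-tail : y ∈ x ∷ xs → y ≢ x → y ∈ xs
∈-tail (here y≡x)   y≢x = ⊥-elim (y≢x y≡x)
∈-tail (there y∈xs) _   = y∈xs

strictlyIncreasing-⊆-antisym : StrictlyIncreasing xs → StrictlyIncreasing ys →
                               xs ⊆ ys → ys ⊆ xs → xs ≡ ys
strictlyIncreasing-⊆-antisym {xs = []}     {ys = []}     _ _ _ _ = refl
strictlyIncreasing-⊆-antisym {xs = []}     {ys = _ ∷ _}  _ _ _ ys⊆xs
  with () ← ys⊆xs (here refl)
strictlyIncreasing-⊆-antisym {xs = _ ∷ _}  {ys = []}     _ _ xs⊆ys _
  with () ← xs⊆ys (here refl)
strictlyIncreasing-⊆-antisym {xs = x ∷ xs} {ys = y ∷ ys} sx sy xs⊆ys ys⊆xs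
  with refl ← ≤-antisym (head-≤ sx (ys⊆xs (here refl))) (head-≤ sy (xs⊆ys (here refl)))
  = cong (x ∷_) (strictlyIncreasing-⊆-antisym (AllPairs.tail sx) (AllPairs.tail sy)
                   (tail-⊆ sx xs⊆ys) (tail-⊆ sy ys⊆xs))
  where
  tail-⊆ : ∀ {zs ws} → StrictlyIncreasing (x ∷ zs) → x ∷ zs ⊆ x ∷ ws → zs ⊆ ws
  tail-⊆ sz ⊆ v∈zs = ∈-tail (⊆ (there v∈zs)) (tail-≢-head sz v∈zs)

Removal : Tuple n → Tuple n → Fin n → Set
Removal R C a = ∀ v → v ∈ R ⇔ (v ∈ C × v ≢ a)

Exchange : Tuple n → Tuple n → Fin n → Fin n → Set
Exchange R C a b = ∀ v → v ∈ R ⇔ ((v ∈ C × v ≢ a) ⊎ v ≡ b)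

exchange-tail : StrictlyIncreasing (x ∷ R) → StrictlyIncreasing (x ∷ C) →
                Exchange (x ∷ R) (x ∷ C) a b → x ≢ b → Exchange R C a b
exchange-tail {R = R} {C = C} {a = a} {b = b} sR sC ex x≢b v = mk⇔ forth back
  where
  forth : v ∈ R → (v ∈ C × v ≢ a) ⊎ v ≡ b
  forth v∈R with to (ex v) (there v∈R)
  ... | inj₁ (v∈xC , v≢a) = inj₁ (∈-tail v∈xC (tail-≢-head sR v∈R) , v≢a)
  ... | inj₂ v≡b          = inj₂ v≡b
  back : (v ∈ C × v ≢ a) ⊎ v ≡ b → v ∈ R
  back (inj₁ (v∈C , v≢a)) =
    ∈-tail (from (ex v) (inj₁ (there v∈C , v≢a))) (tail-≢-head sC v∈C)
  back (inj₂ v≡b) =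
    ∈-tail (from (ex v) (inj₂ v≡b)) (λ v≡x → x≢b (trans (sym v≡x) v≡b))

exchange-removal : StrictlyIncreasing (b ∷ R) → Exchange (b ∷ R) C a b → b ∉ C →
                   Removal R C a
exchange-removal {b = b} {R = R} {C = C} {a = a} sR ex b∉C v = mk⇔ forth back
  where
  forth : v ∈ R → v ∈ C × v ≢ a
  forth v∈R with to (ex v) (there v∈R)
  ... | inj₁ v∈C∖a = v∈C∖a
  ... | inj₂ v≡b   = ⊥-elim (tail-≢-head sR v∈R v≡b)
  back : v ∈ C × v ≢ a → v ∈ R
  back v∈C∖a@(v∈C , _) =
    ∈-tail (from (ex v) (inj₁ v∈C∖a)) (λ v≡b → b∉C (subst (_∈ C) v≡b v∈C))

removal-≤B : StrictlyIncreasing R → StrictlyIncreasing (x ∷ C) → Removal R (x ∷ C) a →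
             a ∈ x ∷ C → R ≤B C
exchange-≤B : StrictlyIncreasing R → StrictlyIncreasing C → Exchange R C a b →
              a ∈ C → b ∉ C → b < a → R ≤B C

removal-≤B {R = R} {x = x} {C = C} {a = a} sR sC rm a∈xC with x ≟ a
... | yes refl = subst (R ≤B_) R≡C (Pointwise.refl ≤-refl)
  where
  R≡C : R ≡ C
  R≡C = strictlyIncreasing-⊆-antisym sR (AllPairs.tail sC)
          (λ {v} v∈R → let v∈xC , v≢x = to (rm v) v∈R in ∈-tail v∈xC v≢x)
          (λ {v} v∈C → from (rm v) (there v∈C , tail-≢-head sC v∈C))
... | no x≢a = exchange-≤B sR (AllPairs.tail sC) ex a∈C x∉C (head-< sC a∈C)
  where
  a∈C : a ∈ C
  a∈C = ∈-tail a∈xC (λ a≡x → x≢a (sym a≡x))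
  x∉C : x ∉ C
  x∉C x∈C = tail-≢-head sC x∈C refl
  ex : Exchange R C a x
  ex v = mk⇔ forth back
    where
    forth : v ∈ R → (v ∈ C × v ≢ a) ⊎ v ≡ x
    forth v∈R with to (rm v) v∈R
    ... | here v≡x  , _   = inj₂ v≡x
    ... | there v∈C , v≢a = inj₁ (v∈C , v≢a)
    back : (v ∈ C × v ≢ a) ⊎ v ≡ x → v ∈ R
    back (inj₁ (v∈C , v≢a)) = from (rm v) (there v∈C , v≢a)
    back (inj₂ refl)        = from (rm v) (here refl , x≢a)

exchange-≤B {R = []} _ _ ex _ _ _ with () ← from (ex _) (inj₂ refl)
exchange-≤B {R = _ ∷ _} {C = []} _ _ _ () _ _
exchange-≤B {R = r ∷ R} {C = c ∷ C} {a = a} {b = b} sR sC ex a∈C b∉C b<a with <-cmp r c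
... | tri< r<c _ _ with to (ex r) (here refl)
...   | inj₁ (r∈cC , _) = ⊥-elim (<-irrefl refl (ℕ.<-≤-trans r<c (head-≤ sC r∈cC)))
...   | inj₂ refl =
  ℕ.<⇒≤ r<c ∷ removal-≤B (AllPairs.tail sR) sC (exchange-removal sR ex b∉C) a∈C
exchange-≤B {R = r ∷ R} {C = c ∷ C} {a = a} {b = b} sR sC ex a∈C b∉C b<a
    | tri≈ _ refl _ =
  ≤-refl ∷ exchange-≤B (AllPairs.tail sR) (AllPairs.tail sC) (exchange-tail sR sC ex c≢b)
                       (∈-tail a∈C a≢c) (λ b∈C → b∉C (there b∈C)) b<a
  where
  c≢b : c ≢ b
  c≢b c≡b = b∉C (here (sym c≡b))
  a≢c : a ≢ c
  a≢c refl with to (ex a) (here refl)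
  ... | inj₁ (_ , a≢a) = a≢a refl
  ... | inj₂ a≡b       = c≢b a≡b
exchange-≤B {R = r ∷ R} {C = c ∷ C} {a = a} {b = b} sR sC ex a∈C b∉C b<a
    | tri> _ _ c<r with c ≟ a
... | no c≢a   = ⊥-elim (<-irrefl refl (ℕ.<-≤-trans c<r r≤c))
  where
  r≤c : r ≤ c
  r≤c = head-≤ sR (from (ex c) (inj₁ (here refl , c≢a)))
... | yes refl = ⊥-elim (<-irrefl refl (ℕ.<-≤-trans c<r (ℕ.≤-trans r≤b (ℕ.<⇒≤ b<a))))
  where
  r≤b : r ≤ b
  r≤b = head-≤ sR (from (ex b) (inj₂ refl))

exchange-sym : Exchange R C a b → a ∈ C → b ∉ C → Exchange C R b a
exchange-sym {R = R} {C = C} {a = a} {b = b} ex a∈C b∉C v = mk⇔ forth back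
  where
  forth : v ∈ C → (v ∈ R × v ≢ b) ⊎ v ≡ a
  forth v∈C with v ≟ a
  ... | yes v≡a = inj₂ v≡a
  ... | no v≢a  = inj₁ (from (ex v) (inj₁ (v∈C , v≢a)) , λ { refl → b∉C v∈C })
  back : (v ∈ R × v ≢ b) ⊎ v ≡ a → v ∈ C
  back (inj₂ refl) = a∈C
  back (inj₁ (v∈R , v≢b)) with to (ex v) v∈R
  ... | inj₁ (v∈C , _) = v∈C
  ... | inj₂ v≡b       = ⊥-elim (v≢b v≡b)

exchange-comparable : StrictlyIncreasing R → StrictlyIncreasing C → Exchange R C a b →
                      a ∈ C → b ∉ C → R ≤B C ⊎ C ≤B R
exchange-comparable {R = R} {a = a} {b = b} sR sC ex a∈C b∉C with <-cmp b a
... | tri< b<a _ _  = inj₁ (exchange-≤B sR sC ex a∈C b∉C b<a)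
... | tri≈ _ refl _ = ⊥-elim (b∉C a∈C)
... | tri> _ _ a<b  = inj₂ (exchange-≤B sC sR (exchange-sym ex a∈C b∉C) b∈R a∉R a<b)
  where
  b∈R : b ∈ R
  b∈R = from (ex b) (inj₂ refl)
  a∉R : a ∉ R
  a∉R a∈R with to (ex a) a∈R
  ... | inj₁ (_ , a≢a) = a≢a refl
  ... | inj₂ refl      = b∉C a∈C

symDiff⇒exchange : IsSymDiff R C a b → a ∈ C → b ∉ C → Exchange R C a b
symDiff⇒exchange {R = R} {C = C} {a = a} {b = b} sd a∈C b∉C v = mk⇔ forth back
  where
  forth : v ∈ R → (v ∈ C × v ≢ a) ⊎ v ≡ b
  forth v∈R with to (sd v) v∈R
  ... | inj₁ (v∈C , v∉ab)      = inj₁ (v∈C , λ v≡a → v∉ab (inj₁ v≡a))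
  ... | inj₂ (v∉C , inj₁ refl) = ⊥-elim (v∉C a∈C)
  ... | inj₂ (_ , inj₂ v≡b)    = inj₂ v≡b
  back : (v ∈ C × v ≢ a) ⊎ v ≡ b → v ∈ R
  back (inj₁ (v∈C , v≢a)) = from (sd v) (inj₁ (v∈C , [ v≢a , (λ { refl → b∉C v∈C }) ]))
  back (inj₂ refl)        = from (sd v) (inj₂ (b∉C , inj₂ refl))

symDiff-comparable : StrictlyIncreasing R → StrictlyIncreasing C → IsSymDiff R C a b →
                     a ∈ C → b ∉ C → R ≤B C ⊎ C ≤B R
symDiff-comparable sR sC sd a∈C b∉C =
  exchange-comparable sR sC (symDiff⇒exchange sd a∈C b∉C) a∈C b∉C

module _ {A : Set} where

  lookup-injective : ∀ {L : List A} → Unique L → ∀ {i j} →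
                     lookup L i ≡ lookup L j → i ≡ j
  lookup-injective {_ ∷ _} (_ ∷ _)      {zero}  {zero}  _ = refl
  lookup-injective {_ ∷ _} (x∉L ∷ _)    {zero}  {suc j} e =
    ⊥-elim (All.lookup x∉L (∈-lookup j) e)
  lookup-injective {_ ∷ _} (x∉L ∷ _)    {suc i} {zero}  e =
    ⊥-elim (All.lookup x∉L (∈-lookup i) (sym e))
  lookup-injective {_ ∷ _} (_ ∷ unique) {suc i} {suc j} e =
    cong suc (lookup-injective unique e)

  AllPairs-lookup : ∀ {R : A → A → Set} {L : List A} → AllPairs R L →
                    ∀ {i j} → i < j → R (lookup L i) (lookup L j)
  AllPairs-lookup {L = _ ∷ _} (Rx ∷ _) {zero}  {suc j} _         = All.lookup Rx (∈-lookup j)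
  AllPairs-lookup {L = _ ∷ _} (_ ∷ RL) {suc i} {suc j} (s≤s i<j) = AllPairs-lookup RL i<j

  Precedes : List A → A → A → Set
  Precedes L x y =
    ∃₂ λ (i j : Fin (length L)) → i < j × lookup L i ≡ x × lookup L j ≡ y

  precedes-∈ˡ : ∀ {L x y} → Precedes L x y → x ∈ L
  precedes-∈ˡ (i , _ , _ , refl , _) = ∈-lookup i

  precedes-∈ʳ : ∀ {L x y} → Precedes L x y → y ∈ L
  precedes-∈ʳ (_ , j , _ , _ , refl) = ∈-lookup j

  precedes-asym : ∀ {L x y} → Unique L → Precedes L x y → ¬ Precedes L y x
  precedes-asym unique (i , j , i<j , refl , refl) (j′ , i′ , j′<i′ , e₁ , e₂)
    with refl ← lookup-injective unique e₁ | refl ← lookup-injective unique e₂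
    = <-asym i<j j′<i′

  precedes-total : ∀ {L x y} → x ∈ L → y ∈ L → x ≢ y →
                   Precedes L x y ⊎ Precedes L y x
  precedes-total {L} x∈L y∈L x≢y with <-cmp (index x∈L) (index y∈L)
  ... | tri< i<j _ _ = inj₁ (_ , _ , i<j , sym (lookup-index x∈L) , sym (lookup-index y∈L))
  ... | tri≈ _ i≡j _ = ⊥-elim (x≢y (trans (lookup-index x∈L)
                                     (trans (cong (lookup L) i≡j) (sym (lookup-index y∈L)))))
  ... | tri> _ _ j<i = inj₂ (_ , _ , j<i , sym (lookup-index y∈L) , sym (lookup-index x∈L))

-- Shellings and linear extensions

ShellingStep : List (Tuple n) → Tuple n → Tuple n → Set
ShellingStep {n} L C D = Σ[ R ∈ Tuple n ] Precedes L R D × Σ[ a ∈ Fin n ] Σ[ b ∈ Fin n ]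
  (a ∈ D × a ∉ C) × (b ∈ R × b ∉ D) × IsSymDiff R D a b

Shelling : List (Tuple n) → Set
Shelling L = ∀ {C D} → Precedes L C D → ShellingStep L C D

BruhatRespecting : List (Tuple n) → Set
BruhatRespecting L = ∀ {C D} → C ∈ L → D ∈ L → C <B D → Precedes L C D

shellingOrder⇒shelling : ∀ {L : List (Tuple n)} → ShellingOrder L → Shelling L
shellingOrder⇒shelling (_ , shell) (i , j , i<j , refl , refl)
  with r , r<j , a , b , a∈D∖C , b∈R∖D , sd ← shell i j i<j
  = _ , (r , j , r<j , refl , refl) , a , b , a∈D∖C , b∈R∖D , sd

ShellingStepAt : (L : List (Tuple n)) → Fin (length L) → Fin (length L) → Set
ShellingStepAt L i j = Σ[ r ∈ Fin (length L) ] r < j × Σ[ a ∈ Fin _ ] Σ[ b ∈ Fin _ ]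
  (a ∈ lookup L j × a ∉ lookup L i) × (b ∈ lookup L r × b ∉ lookup L j) ×
  IsSymDiff (lookup L r) (lookup L j) a b

shelling⇒shellingOrder : ∀ {L : List (Tuple n)} → Unique L → Shelling L → ShellingOrder L
shelling⇒shellingOrder {L = L} unique shell = unique , shellAt
  where
  shellAt : ∀ i j → i < j → ShellingStepAt L i j
  shellAt i j i<j
    with R , (r , j′ , r<j′ , refl , lookup-j′≡lookup-j) , a , b , a∈D∖C , b∈R∖D , sd
           ← shell (i , j , i<j , refl , refl)
    with refl ← lookup-injective unique lookup-j′≡lookup-j
    = r , r<j′ , a , b , a∈D∖C , b∈R∖D , sd

linearExtension⇒bruhatRespecting : ∀ {P L : List (Tuple n)} → LinearExtension P L →
                                   BruhatRespecting L
linearExtension⇒bruhatRespecting {L = L} (_ , monotone) C∈L D∈L C<D =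
  index C∈L , index D∈L , monotone _ _ C<D′ ,
  sym (lookup-index C∈L) , sym (lookup-index D∈L)
  where
  C<D′ : lookup L (index C∈L) <B lookup L (index D∈L)
  C<D′ = subst₂ _<B_ (lookup-index C∈L) (lookup-index D∈L) C<D

module _ {L₀ L : List (Tuple n)} (L₀↭L : L₀ ↭ L) (unique₀ : Unique L₀) (unique : Unique L)
         (increasing : ∀ {C} → C ∈ L → StrictlyIncreasing C)
         (respects₀ : BruhatRespecting L₀) (respects : BruhatRespecting L)
         (shelling₀ : Shelling L₀)
  where

  private
    L₀⊆L : L₀ ⊆ L
    L₀⊆L = ∈-resp-↭ L₀↭L

    L⊆L₀ : L ⊆ L₀
    L⊆L₀ = ∈-resp-↭ (↭-sym L₀↭L)

  exchange-precedes : ∀ {R D a b} → Precedes L₀ R D → IsSymDiff R D a b →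
                      a ∈ D → b ∈ R → b ∉ D → Precedes L R D
  exchange-precedes {R} {D} RD₀ sd a∈D b∈R b∉D =
    [ below , above ] (symDiff-comparable (increasing R∈L) (increasing D∈L) sd a∈D b∉D)
    where
    R∈L : R ∈ L
    R∈L = L₀⊆L (precedes-∈ˡ RD₀)
    D∈L : D ∈ L
    D∈L = L₀⊆L (precedes-∈ʳ RD₀)
    R≢D : R ≢ D
    R≢D refl = b∉D b∈R
    below : R ≤B D → Precedes L R D
    below R≤D = respects R∈L D∈L (R≤D , R≢D)
    above : D ≤B R → Precedes L R D
    above D≤R = ⊥-elim (precedes-asym unique₀ RD₀
      (respects₀ (precedes-∈ʳ RD₀) (precedes-∈ˡ RD₀) (D≤R , λ D≡R → R≢D (sym D≡R))))

  shellingStep-transfer : ∀ i → Acc _<_ i → ∀ j → i < j →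
                          ShellingStep L (lookup L i) (lookup L j)
  shellingStep-transfer i (acc smaller) j i<j
    with precedes-total (L⊆L₀ (∈-lookup i)) (L⊆L₀ (∈-lookup j))
                        (λ e → <-irrefl (lookup-injective unique e) i<j)
  ... | inj₁ CD₀
    with R , RD₀ , a , b , (a∈D , a∉C) , (b∈R , b∉D) , sd ← shelling₀ CD₀
    = R , exchange-precedes RD₀ sd a∈D b∈R b∉D , a , b , (a∈D , a∉C) , (b∈R , b∉D) , sd
  ... | inj₂ DC₀
    with R , RC₀ , a , b , (a∈C , a∉D) , (b∈R , b∉C) , sd ← shelling₀ DC₀
    with k , i′ , k<i′ , refl , lookup-i′≡lookup-i ← exchange-precedes RC₀ sd a∈C b∈R b∉C
    with refl ← lookup-injective unique lookup-i′≡lookup-i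
    with R′ , R′D , a′ , b′ , (a′∈D , a′∉R) , rest
           ← shellingStep-transfer k (smaller k<i′) j (<-trans k<i′ i<j)
    = R′ , R′D , a′ , b′ , (a′∈D , a′∉C) , rest
    where
    -- a′ ∈ D rules out a′ = a and b ∉ C rules out a′ = b, so a′ ∈ C would put a′ in
    -- R = C + {a, b}.
    a′∉C : a′ ∉ lookup L i
    a′∉C a′∈C = a′∉R (from (sd a′)
      (inj₁ (a′∈C , [ (λ { refl → a∉D a′∈D }) , (λ { refl → b∉C a′∈C }) ])))

  shelling-transfer : Shelling L
  shelling-transfer (i , j , i<j , refl , refl) =
    shellingStep-transfer i (<-wellFounded i) j i<j

unique-resp-↭ : ∀ {A : Set} {xs ys : List A} → xs ↭ ys → Unique xs → Unique ys
unique-resp-↭ {A} xs↭ys = PermutationSetoid.Unique-resp-↭ (setoid A) (↭⇒↭ₛ xs↭ys)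

linearExtension-shelling-transfer : ∀ {P L₀ L : List (Tuple n)} →
                                    (∀ {C} → C ∈ P → StrictlyIncreasing C) →
                                    LinearExtension P L₀ → ShellingOrder L₀ →
                                    LinearExtension P L → ShellingOrder L
linearExtension-shelling-transfer {L₀ = L₀} {L = L}
    increasing ext₀@(L₀↭P , _) order₀@(unique₀ , _) ext@(L↭P , _) =
  shelling⇒shellingOrder unique
    (shelling-transfer L₀↭L unique₀ unique (λ C∈L → increasing (∈-resp-↭ L↭P C∈L))
      (linearExtension⇒bruhatRespecting ext₀) (linearExtension⇒bruhatRespecting ext)
      (shellingOrder⇒shelling order₀))
  where
  L₀↭L : L₀ ↭ L
  L₀↭L = ↭-trans L₀↭P (↭-sym L↭P)
  unique : Unique L
  unique = unique-resp-↭ L₀↭L unique₀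

-- The lexicographic order

_≤lex_ : Tuple n → Tuple n → Set
_≤lex_ = Lex-≤ _≡_ _<_

≤B∧≢⇒<lex : ∀ {x y : Tuple n} → x ≤B y → x ≢ y → x <lex y
≤B∧≢⇒<lex [] x≢y = ⊥-elim (x≢y refl)
≤B∧≢⇒<lex {x = a ∷ _} {y = b ∷ _} (a≤b ∷ xs≤ys) x≢y with a ≟ b
... | yes refl = next refl (≤B∧≢⇒<lex xs≤ys (λ xs≡ys → x≢y (cong (a ∷_) xs≡ys)))
... | no a≢b   = this (≤∧≢⇒< a≤b a≢b)

<lex-asym : ∀ {x y : Tuple n} → x <lex y → ¬ y <lex x
<lex-asym = <-asymmetric sym <-resp₂-≡ <-asym

≤lex⇒≯lex : ∀ {x y : Tuple n} → x ≤lex y → ¬ y <lex x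
≤lex⇒≯lex (this a<b)      (this b<a)    = <-asym a<b b<a
≤lex⇒≯lex (this a<a)      (next refl _) = <-irrefl refl a<a
≤lex⇒≯lex (next refl _)   (this a<a)    = <-irrefl refl a<a
≤lex⇒≯lex (next refl x≤y) (next _ y<x)  = ≤lex⇒≯lex x≤y y<x

≤lex∧≢⇒<lex : ∀ {x y : Tuple n} → x ≤lex y → x ≢ y → x <lex y
≤lex∧≢⇒<lex (base _)        x≢y = ⊥-elim (x≢y refl)
≤lex∧≢⇒<lex halt            _   = halt
≤lex∧≢⇒<lex (this a<b)      _   = this a<b
≤lex∧≢⇒<lex (next refl x≤y) x≢y =
  next refl (≤lex∧≢⇒<lex x≤y (λ xs≡ys → x≢y (cong (_ ∷_) xs≡ys)))

lexUnreversed⇒linearExtension : ∀ {P L : List (Tuple n)} → L ↭ P →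
                                AllPairs (λ x y → ¬ y <lex x) L → LinearExtension P L
lexUnreversed⇒linearExtension {L = L} L↭P unreversed = L↭P , monotone
  where
  monotone : ∀ i j → lookup L i <B lookup L j → i < j
  monotone i j (x≤y , x≢y) with <-cmp i j
  ... | tri< i<j _ _  = i<j
  ... | tri≈ _ refl _ = ⊥-elim (x≢y refl)
  ... | tri> _ _ j<i  = ⊥-elim (AllPairs-lookup unreversed j<i (≤B∧≢⇒<lex x≤y x≢y))

lexListing⇒linearExtension : ∀ {P L : List (Tuple n)} → LexListing P L →
                             LinearExtension P L
lexListing⇒linearExtension (L↭P , lexIncreasing) =
  lexUnreversed⇒linearExtension L↭P (AllPairs.map <lex-asym lexIncreasing)

lexDecTotalOrder : ℕ → DecTotalOrder 0ℓ 0ℓ 0ℓ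
lexDecTotalOrder n = Lex.≤-decTotalOrder (<-strictTotalOrder n)

sortLex : List (Tuple n) → List (Tuple n)
sortLex {n} = Sort.sort (lexDecTotalOrder n)

sortLex-↭ : (P : List (Tuple n)) → sortLex P ↭ P
sortLex-↭ {n} = Sort.sort-↭ (lexDecTotalOrder n)

sortLex-≤lex : (P : List (Tuple n)) → AllPairs _≤lex_ (sortLex P)
sortLex-≤lex {n} P =
  Sorted⇒AllPairs (DecTotalOrder.totalOrder (lexDecTotalOrder n))
                  (Sort.sort-↗ (lexDecTotalOrder n) P)

sortLex-linearExtension : (P : List (Tuple n)) → LinearExtension P (sortLex P)
sortLex-linearExtension P =
  lexUnreversed⇒linearExtension (sortLex-↭ P) (AllPairs.map ≤lex⇒≯lex (sortLex-≤lex P))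

sortLex-lexListing : {P : List (Tuple n)} → Unique P → LexListing P (sortLex P)
sortLex-lexListing {P = P} unique =
  sortLex-↭ P , AllPairs.zipWith (λ (x≤y , x≢y) → ≤lex∧≢⇒<lex x≤y x≢y)
                  (sortLex-≤lex P , unique-resp-↭ (↭-sym (sortLex-↭ P)) unique)

sortFin-increasing : {xs : Tuple n} → Unique xs → StrictlyIncreasing (sortFin xs)
sortFin-increasing {n} {xs} unique =
  AllPairs.zipWith (λ (x≤y , x≢y) → ≤∧≢⇒< x≤y x≢y)
    (Sorted⇒AllPairs (≤-totalOrder n) (Sort.sort-↗ (≤-decTotalOrder n) xs) ,
     unique-resp-↭ (↭-sym (Sort.sort-↭ (≤-decTotalOrder n) xs)) unique)

image-increasing : ∀ {d} (σ : Fin n ⤖ Fin n) (X : PureComplex n d) {C} →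
                   C ∈ image σ X → StrictlyIncreasing C
image-increasing σ X C∈image with F , F∈X , refl ← ∈-map⁻ (σ-facet σ) C∈image =
  sortFin-increasing (Unique.map⁺ (Bijection.injective σ)
                       (AllPairs.map <⇒≢ (All.lookup (facet-sorted X) F∈X)))

theorem3p2 : (n d : ℕ) → n ≥ 1 → (X : PureComplex n d) →
    (LinearlyShellable X ⇔ LexShellable X) × (LinearlyShellable X ⇔ AllExtensionsShell X)
theorem3p2 n d _ X = mk⇔ linear⇒lex lex⇒linear , mk⇔ linear⇒all all⇒linear
  where
  linear⇒all : LinearlyShellable X → AllExtensionsShell X
  linear⇒all (σ , _ , ext₀ , order₀) =
    σ , λ _ ext → linearExtension-shelling-transfer (image-increasing σ X) ext₀ order₀ ext

  all⇒linear : AllExtensionsShell X → LinearlyShellable X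
  all⇒linear (σ , allShell) =
    σ , _ , sortLex-linearExtension _ , allShell _ (sortLex-linearExtension _)

  linear⇒lex : LinearlyShellable X → LexShellable X
  linear⇒lex shellable@(σ , _ , (L₀↭P , _) , (unique₀ , _)) =
    σ , _ , listing , proj₂ (linear⇒all shellable) _ (lexListing⇒linearExtension listing)
    where
    listing : LexListing (image σ X) (sortLex (image σ X))
    listing = sortLex-lexListing (unique-resp-↭ L₀↭P unique₀)

  lex⇒linear : LexShellable X → LinearlyShellable X
  lex⇒linear (σ , L , listing , order) = σ , L , lexListing⇒linearExtension listing , order
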